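{- Let $n\geq 1$, $k\geq 0$, $m\geq 0$. The map $\phi$ is a bijection between the sets $\mathcal{C}_n^k(m,R*)$ and $\mathcal{C}_{n-1}^{k+1}(m,*)\setminus \mathcal{C}_{n-1}^{k+1}(m,*,|m')$.
   Context: Callan sequences. Let $k,n\geq 0$, blue set $K=\{1,\dots,k\}\cup\{*\}$, red set $N=\{1,\dots,n\}\cup\{*\}$. A Callan sequence of size $k\times n$ is a sequence $(B_1,R_1)(B_2,R_2)\cdots(B_p,R_p)(B^*,R^*)$, $0\le p\le n$, where $\{B_1,\dots,B_p,B^*\}$ is a set partition of $K$ into $p+1$ nonempty blocks, $\{R_1,\dots,R_p,R^*\}$ is a set partition of $N$ into $p+1$ nonempty blocks, the blue $*$ lies in $B^*$ and the red $*$ lies in $R^*$. The pairs $(B_i,R_i)$ are ordinary pairs, $(B^*,R^*)$ is the extra pair; $B^*,R^*$ are the extra blocks. $m$-barred Callan sequences. $\mathcal{C}_n^k(m)$ is the set of sequences whose elements are: $m$ blue bars labelled $1,\dots,m$, $m+1$ red bars labelled $0,\dots,m$, and the Callan pairs of a $k\times n$ Callan sequence with labels shifted up by $m$ (blue base set $\{m+1,\dots,m+k\}\cup\{*\}$, red base set $\{m+1,\dots,m+n\}\cup\{*\}$, pairs keeping their relative order, extra pair last), arranged so that a blue bar with label $i$ is followed by a bar with label strictly smaller than $i$, and a red bar with label $i$ is followed either by a Callan pair or by a bar with label strictly greater than $i$. Each Callan pair is associated with the (possibly empty) maximal group of consecutive bars immediately preceding it. Subsets. $\mathcal{C}_n^k(m,*)$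 is the subset of $\mathcal{C}_n^k(m)$ whose extra red block is $\{*\}$ only; $\mathcal{C}_n^k(m,R*)=\mathcal{C}_n^k(m)\setminus\mathcal{C}_n^k(m,*)$ (extra red block contains some red element besides $*$). For $k\ge1$, $\mathcal{C}_n^k(m,*,|m')$ is the subset of $\mathcal{C}_n^k(m,*)$ of elements in which the maximal blue element $m'=m+k$ forms a singleton blue block of an ordinary pair and at least one bar precedes this pair; for $k=0$ this set is empty. The map $\phi:\mathcal{C}_n^k(m,R*)\to\mathcal{C}_{n-1}^{k+1}(m,*)$. Let $\alpha\in\mathcal{C}_n^k(m,R*)$; remove the maximal red element $m+n$ and add the new blue element $m'=m+k+1$, according to four cases: A1) $R^*=\{m+n,*\}$: delete $m+n$ and add $m'$ to the blue block of the first Callan pair. A2) $m+n\in R^*$ and $R'=R^*\setminus\{m+n\}\neq\{*\}$: replace $R^*$ by $\{*\}$ and put the pair $(\{m'\},R'\setminus\{*\})$ at the front of the sequence. B1) $R_i=\{m+n\}$ for an ordinary pair $(B_i,R_i)$: replace $R^*$ by $\{*\}$, replace $R_i$ by $R^*\setminus\{*\}$, move the new pair $(B_i,R^*\setminus\{*\})$ together with its group of preceding bars to the front of the sequence, and add $m'$ to the $(i+1)$st blue block ($B_{i+1}$, or $B^*$ if $(B_i,R_i)$ was the last ordinary pair). B2) $m+n\in R_i$ for an ordinary pair with $R'=R_i\setminus\{m+n\}\neq\varnothing$: replace $R^*$ by $\{*\}$, replace $(B_i,R_i)$ by the two consecutive pairs $(B_i,R^*\setminus\{*\})$ and $(\{m'\},R')$,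 and move $(B_i,R^*\setminus\{*\})$ together with its group of preceding bars to the front of the sequence. -}

module Defs where

open import Data.Nat using (ℕ; zero; suc; _+_; _<_; _≡ᵇ_)
open import Data.Bool using (Bool; true; false; if_then_else_; _∨_)
open import Data.List using (List; []; _∷_; _++_; [_]; concatMap; map)
open import Data.Product using (_×_; _,_; proj₁; proj₂)
open import Data.Maybe using (Maybe; just; nothing)
open import Data.Unit using (⊤)
open import Data.Empty using (⊥)
open import Relation.Nullary using (¬_)
open import Relation.Binary.PropositionalEquality using (_≡_)
open import Data.List.Relation.Unary.Linked using (Linked)
open import Data.List.Relation.Unary.All using (All)
open import Data.List.Relation.Unary.Any using (Any)
open import Data.List.Relation.Binary.Permutation.Propositional using (_↭_)

range : ℕ → ℕ → List ℕ
range a zero    = []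
range a (suc l) = a ∷ range (suc a) l

-- Raw representation of m-barred Callan sequences.
--
-- Blocks are stored as strictly increasing lists of naturals (canonical
-- representation of finite sets).  The extra blocks B*, R* always contain
-- the stars, so only B* \ {*} and R* \ {*} are stored (possibly empty).
-- Every Callan pair is stored together with the (possibly empty) group
-- of bars immediately preceding it; the extra pair is the last element.

data Bar : Set where
  blueBar : ℕ → Bar
  redBar  : ℕ → Bar

barLabel : Bar → ℕ
barLabel (blueBar i) = i
barLabel (redBar i)  = i

record Pair : Set where
  constructor mkPair
  field
    blues : List ℕ
    reds  : List ℕ
open Pair public

Seg : Set
Seg = List Bar × Pair

record BCS : Set where
  constructor mkBCS
  field
    ordinary  : List Seg
    extraBars : List Bar
    extraB    : List ℕ
    extraR    : List ℕ
open BCS public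

data Elem : Set where
  barE  : Bar → Elem
  pairE : Elem

AdjOK : Elem → Elem → Set
AdjOK (barE (blueBar i)) (barE b) = barLabel b < i
AdjOK (barE (blueBar i)) pairE    = ⊥
AdjOK (barE (redBar i))  (barE b) = i < barLabel b
AdjOK (barE (redBar i))  pairE    = ⊤
AdjOK pairE              _        = ⊤

flatten : BCS → List Elem
flatten s = concatMap (λ sg → map barE (proj₁ sg) ++ [ pairE ]) (ordinary s)
            ++ map barE (extraBars s) ++ [ pairE ]

allBars : BCS → List Bar
allBars s = concatMap proj₁ (ordinary s) ++ extraBars s

blueLabels : List Bar → List ℕ
blueLabels []               = []
blueLabels (blueBar i ∷ bs) = i ∷ blueLabels bs
blueLabels (redBar i ∷ bs)  = blueLabels bs

redLabels : List Bar → List ℕ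
redLabels []               = []
redLabels (blueBar i ∷ bs) = redLabels bs
redLabels (redBar i ∷ bs)  = i ∷ redLabels bs

Increasing : List ℕ → Set
Increasing = Linked _<_

NonEmpty : List ℕ → Set
NonEmpty l = ¬ (l ≡ [])

ordBlues : BCS → List ℕ
ordBlues s = concatMap (λ sg → blues (proj₂ sg)) (ordinary s)

ordReds : BCS → List ℕ
ordReds s = concatMap (λ sg → reds (proj₂ sg)) (ordinary s)

record InC (m k n : ℕ) (s : BCS) : Set where
  field
    blueBarsOK   : blueLabels (allBars s) ↭ range 1 m
    redBarsOK    : redLabels (allBars s) ↭ range 0 (suc m)
    barOrder     : Linked AdjOK (flatten s)
    ordBluesInc  : All (λ sg → Increasing (blues (proj₂ sg))) (ordinary s)
    ordRedsInc   : All (λ sg → Increasing (reds (proj₂ sg))) (ordinary s)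
    ordBluesNE   : All (λ sg → NonEmpty (blues (proj₂ sg))) (ordinary s)
    ordRedsNE    : All (λ sg → NonEmpty (reds (proj₂ sg))) (ordinary s)
    extraBInc    : Increasing (extraB s)
    extraRInc    : Increasing (extraR s)
    bluePartition : ordBlues s ++ extraB s ↭ range (suc m) k
    redPartition  : ordReds s ++ extraR s ↭ range (suc m) n

InCStar : ℕ → ℕ → ℕ → BCS → Set
InCStar m k n s = InC m k n s × extraR s ≡ []

InCRStar : ℕ → ℕ → ℕ → BCS → Set
InCRStar m k n s = InC m k n s × ¬ (extraR s ≡ [])

SingletonMaxPreceded : ℕ → ℕ → BCS → Set
SingletonMaxPreceded m zero    s = ⊥
SingletonMaxPreceded m (suc k) s =
  Any (λ sg → blues (proj₂ sg) ≡ [ m + suc k ] × ¬ (proj₁ sg ≡ [])) (ordinary s)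

InCStarBar : ℕ → ℕ → ℕ → BCS → Set
InCStarBar m k n s = InCStar m k n s × SingletonMaxPreceded m k s

elemᵇ : ℕ → List ℕ → Bool
elemᵇ r []       = false
elemᵇ r (x ∷ xs) = (x ≡ᵇ r) ∨ elemᵇ r xs

remove : ℕ → List ℕ → List ℕ
remove r []       = []
remove r (x ∷ xs) = if x ≡ᵇ r then remove r xs else x ∷ remove r xs

null : List ℕ → Bool
null []      = true
null (_ ∷ _) = false

-- add x (larger than all blue elements) to the blue block of the first pair
-- among the given ordinary pairs, or to the extra blue block if there is none
addBlueFirst : ℕ → List Seg → List ℕ → List Seg × List ℕ
addBlueFirst x []              eb = [] , eb ++ [ x ]
addBlueFirst x ((g , p) ∷ ps) eb = (g , mkPair (blues p ++ [ x ]) (reds p)) ∷ ps , eb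

findRed : ℕ → List Seg → Maybe (List Seg × Seg × List Seg)
findRed r [] = nothing
findRed r (sg ∷ ps) with elemᵇ r (reds (proj₂ sg))
... | true  = just ([] , sg , ps)
... | false with findRed r ps
...   | nothing                 = nothing
...   | just (pre , x , post)   = just (sg ∷ pre , x , post)

phiA : ℕ → ℕ → BCS → BCS
phiA r m' (mkBCS ord eBars eB eR) with null (remove r eR)
... | true  = let res = addBlueFirst m' ord eB
              in mkBCS (proj₁ res) eBars (proj₂ res) []
... | false = mkBCS (([] , mkPair [ m' ] (remove r eR)) ∷ ord) eBars eB []

phiB : ℕ → ℕ → BCS → BCS
phiB r m' s@(mkBCS ord eBars eB eR) with findRed r ord
... | nothing = s   -- does not occur for valid inputs
... | just (pre , (g , p) , post) with null (remove r (reds p))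
...   | true  = let res = addBlueFirst m' post eB
                in mkBCS ((g , mkPair (blues p) eR) ∷ pre ++ proj₁ res) eBars (proj₂ res) []
...   | false = mkBCS ((g , mkPair (blues p) eR) ∷ pre
                        ++ ([] , mkPair [ m' ] (remove r (reds p))) ∷ post) eBars eB []

-- φ : C_n^k(m,R*) → C_{n-1}^{k+1}(m,*), removing r = m+n, adding m' = m+k+1
phi : ℕ → ℕ → ℕ → BCS → BCS
phi m k n s with elemᵇ (m + n) (extraR s)
... | true  = phiA (m + n) (m + suc k) s
... | false = phiB (m + n) (m + suc k) s

-- Every case of φ is the composite of two moves.  If r = m+n lies in an ordinary
-- pair (B1, B2), that pair moves with its bars to the front and takes over the extra
-- red block; otherwise (A1, A2) nothing moves.  Then r is deleted and m′ = m+k+1 is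
-- inserted where r's pair stood (at the start, in case A): it joins the next blue
-- block or, if r's red block kept elements R′, forms the new bar-free pair ({m′}, R′).
-- So m′ is never a barred singleton, and ψ inverts φ by locating m′: the pairs before
-- its block are the moved pair and the pairs it jumped over, and whether m′ forms an
-- ordinary singleton block tells whether R′ was empty.

module Submission where

open import Defs
open import Data.Nat using (ℕ; zero; suc; _+_; _<_; _≤_; _∸_; _≡ᵇ_; s≤s)
open import Data.Nat.Properties
  using (<-irrefl; <⇒≤; ≤-refl; ≤-reflexive; ≤-trans; +-suc; +-identityʳ; m≤m+n; ≡ᵇ⇒≡)
open import Data.Bool using (true; false; T; _∨_)
open import Data.Bool.Properties using (∨-assoc; ∨-zeroʳ)
open import Data.Maybe using (Maybe; just; nothing)
open import Data.List using (List; []; _∷_; _++_; [_]; concatMap; map; mapMaybe)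
open import Data.List.Properties using (++-assoc; ++-identityʳ; map-++; concat-++)
open import Data.List.Membership.Propositional using (_∈_)
open import Data.List.Membership.Propositional.Properties using (∈-++⁺ʳ; ∈-++⁻)
open import Data.List.Relation.Unary.Linked using (Linked; []; [-]; _∷_)
open import Data.List.Relation.Unary.All using (All; []; _∷_)
import Data.List.Relation.Unary.All as All
import Data.List.Relation.Unary.All.Properties as All
open import Data.List.Relation.Unary.Any using (Any; here; there)
open import Data.List.Relation.Binary.Permutation.Propositional
import Data.List.Relation.Binary.Permutation.Propositional.Properties as ↭
open import Data.Product using (Σ; _×_; _,_; proj₁; proj₂)
open import Function using (_∘_)
open import Data.Sum using (inj₁; inj₂)
open import Data.Unit using (tt)
open import Data.Empty using (⊥-elim)
open import Relation.Nullary using (¬_)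
open import Relation.Binary.PropositionalEquality using (_≡_; refl; sym; cong; cong₂; subst)
  renaming (trans to ≡-trans)
open import Algebra.Solver.CommutativeMonoid (↭.++-commutativeMonoid {A = ℕ}) using (solve; _⊕_; _⊜_; id)

-- Lists of naturals: membership, removal and maxima

≡ᵇ-refl : ∀ n → (n ≡ᵇ n) ≡ true
≡ᵇ-refl zero    = refl
≡ᵇ-refl (suc n) = ≡ᵇ-refl n

<⇒≡ᵇ-false : ∀ {x r} → x < r → (x ≡ᵇ r) ≡ false
<⇒≡ᵇ-false {zero}  {suc r} _       = refl
<⇒≡ᵇ-false {suc x} {suc r} (s≤s p) = <⇒≡ᵇ-false p

≡ᵇ-true⇒≡ : ∀ {x r} → (x ≡ᵇ r) ≡ true → x ≡ r
≡ᵇ-true⇒≡ {x} {r} e = ≡ᵇ⇒≡ x r (subst T (sym e) tt)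

elemᵇ-++ : ∀ r xs ys → elemᵇ r (xs ++ ys) ≡ (elemᵇ r xs ∨ elemᵇ r ys)
elemᵇ-++ r []       ys = refl
elemᵇ-++ r (x ∷ xs) ys rewrite elemᵇ-++ r xs ys = sym (∨-assoc (x ≡ᵇ r) _ _)

elemᵇ-∷ʳ : ∀ r xs → elemᵇ r (xs ++ [ r ]) ≡ true
elemᵇ-∷ʳ r xs rewrite elemᵇ-++ r xs [ r ] | ≡ᵇ-refl r = ∨-zeroʳ (elemᵇ r xs)

elemᵇ-[-] : ∀ r → elemᵇ r [ r ] ≡ true
elemᵇ-[-] r = elemᵇ-∷ʳ r []

∈⇒elemᵇ : ∀ {x xs} → x ∈ xs → elemᵇ x xs ≡ true
∈⇒elemᵇ {x}          (here refl) rewrite ≡ᵇ-refl x = refl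
∈⇒elemᵇ {x} {y ∷ xs} (there p)   rewrite ∈⇒elemᵇ p = ∨-zeroʳ (y ≡ᵇ x)

All<⇒elemᵇ-false : ∀ {r xs} → All (_< r) xs → elemᵇ r xs ≡ false
All<⇒elemᵇ-false []       = refl
All<⇒elemᵇ-false (p ∷ ps) rewrite <⇒≡ᵇ-false p | All<⇒elemᵇ-false ps = refl

remove-∷ʳ : ∀ {r xs} → All (_< r) xs → remove r (xs ++ [ r ]) ≡ xs
remove-∷ʳ {r} []       rewrite ≡ᵇ-refl r = refl
remove-∷ʳ     (p ∷ ps) rewrite <⇒≡ᵇ-false p | remove-∷ʳ ps = refl

remove-[-] : ∀ r → remove r [ r ] ≡ []
remove-[-] r = remove-∷ʳ {r} []

null-true⇒[] : ∀ {xs : List ℕ} → null xs ≡ true → xs ≡ []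
null-true⇒[] {[]} _ = refl

null-false⇒NonEmpty : ∀ {xs : List ℕ} → null xs ≡ false → NonEmpty xs
null-false⇒NonEmpty {_ ∷ _} _ ()

NonEmpty⇒null-false : ∀ {xs : List ℕ} → NonEmpty xs → null xs ≡ false
NonEmpty⇒null-false {[]}    ne = ⊥-elim (ne refl)
NonEmpty⇒null-false {_ ∷ _} _  = refl

NonEmpty-∷ʳ : ∀ (r : ℕ) xs → NonEmpty (xs ++ [ r ])
NonEmpty-∷ʳ r []      ()
NonEmpty-∷ʳ r (_ ∷ _) ()

∷ʳ≢[-] : ∀ {r : ℕ} {xs} → NonEmpty xs → ¬ (xs ++ [ r ] ≡ [ r ])
∷ʳ≢[-] {xs = []}        ne _ = ne refl
∷ʳ≢[-] {xs = _ ∷ []}    _  ()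
∷ʳ≢[-] {xs = _ ∷ _ ∷ _} _  ()

All<⇒≢[-] : ∀ {r xs} → All (_< r) xs → ¬ (xs ≡ [ r ])
All<⇒≢[-] (p ∷ []) refl = <-irrefl refl p

Increasing-∷ʳ : ∀ {r} xs → Increasing xs → All (_< r) xs → Increasing (xs ++ [ r ])
Increasing-∷ʳ []           _       _            = [-]
Increasing-∷ʳ (x ∷ [])     _       (p ∷ [])     = p ∷ [-]
Increasing-∷ʳ (x ∷ y ∷ xs) (p ∷ l) (_ ∷ y∷xs<r) = p ∷ Increasing-∷ʳ (y ∷ xs) l y∷xs<r

Increasing-++⁻ˡ : ∀ xs {ys} → Increasing (xs ++ ys) → Increasing xs
Increasing-++⁻ˡ []           _       = []
Increasing-++⁻ˡ (x ∷ [])     _       = [-]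
Increasing-++⁻ˡ (x ∷ y ∷ xs) (p ∷ l) = p ∷ Increasing-++⁻ˡ (y ∷ xs) l

split-max : ∀ {r xs} → Increasing xs → All (_≤ r) xs → elemᵇ r xs ≡ true →
            xs ≡ remove r xs ++ [ r ]
split-max {r} {x ∷ []} _ _ e with x ≡ᵇ r in x≡ᵇr
... | true  = cong [_] (≡ᵇ-true⇒≡ x≡ᵇr)
... | false with () ← e
split-max {r} {x ∷ y ∷ ys} (x<y ∷ l) (_ ∷ y≤r ∷ ys≤r) e
  rewrite <⇒≡ᵇ-false (≤-trans x<y y≤r) = cong (x ∷_) (split-max l (y≤r ∷ ys≤r) e)

Increasing-remove-max : ∀ {r xs} → Increasing xs → All (_≤ r) xs → elemᵇ r xs ≡ true →
                        Increasing (remove r xs)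
Increasing-remove-max {r} {xs} l a e =
  Increasing-++⁻ˡ (remove r xs) (subst Increasing (split-max l a e) l)

range-suc : ∀ a l → range a (suc l) ≡ range a l ++ [ a + l ]
range-suc a zero    = cong [_] (sym (+-identityʳ a))
range-suc a (suc l) rewrite range-suc (suc a) l | +-suc a l = refl

range-All< : ∀ a l {b} → a + l ≤ b → All (_< b) (range a l)
range-All< a zero    _ = []
range-All< a (suc l) h rewrite +-suc a l = ≤-trans (m≤m+n (suc a) l) h ∷ range-All< (suc a) l h

↭-∷ʳ-cancel : ∀ {x : ℕ} xs ys → xs ++ [ x ] ↭ ys ++ [ x ] → xs ↭ ys
↭-∷ʳ-cancel {x} xs ys p with ↭.drop-mid {x = x} xs ys {[]} {[]} p
... | q rewrite ++-identityʳ xs | ++-identityʳ ys = q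

∈-++-elemᵇ-false : ∀ {x} xs {ys} → x ∈ xs ++ ys → elemᵇ x ys ≡ false → x ∈ xs
∈-++-elemᵇ-false xs x∈ x∉ys with ∈-++⁻ xs x∈
... | inj₁ x∈xs = x∈xs
... | inj₂ x∈ys with () ← ≡-trans (sym (∈⇒elemᵇ x∈ys)) x∉ys

-- Segments and well-formedness

segBars : Seg → List Bar
segBars = proj₁

segBlues : Seg → List ℕ
segBlues sg = blues (proj₂ sg)

segReds : Seg → List ℕ
segReds sg = reds (proj₂ sg)

concatMap-++ : ∀ {A : Set} (f : Seg → List A) xs ys →
               concatMap f (xs ++ ys) ≡ concatMap f xs ++ concatMap f ys
concatMap-++ f xs ys rewrite map-++ f xs ys = sym (concat-++ (map f xs) (map f ys))

All-concatMap⁻ : ∀ {P : ℕ → Set} (f : Seg → List ℕ) ord → All P (concatMap f ord) → All (λ sg → All P (f sg)) ord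
All-concatMap⁻ f ord a = All.map⁻ {f = f} (All.concat⁻ a)

All-concatMap-++⁻ : ∀ {P : ℕ → Set} (f : Seg → List ℕ) xs ys → All P (concatMap f (xs ++ ys)) →
                    All P (concatMap f xs) × All P (concatMap f ys)
All-concatMap-++⁻ f xs ys a rewrite concatMap-++ f xs ys = All.++⁻ (concatMap f xs) a

All-concatMap-mid⁻ : ∀ {P : ℕ → Set} (f : Seg → List ℕ) pre x post → All P (concatMap f (pre ++ x ∷ post)) →
                     All P (concatMap f pre) × All P (f x) × All P (concatMap f post)
All-concatMap-mid⁻ f pre x post a with All-concatMap-++⁻ f pre (x ∷ post) a
... | a-pre , a-rest = a-pre , All.++⁻ (f x) a-rest

findSeg : (Seg → List ℕ) → ℕ → List Seg → Maybe (List Seg × Seg × List Seg)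
findSeg f x [] = nothing
findSeg f x (sg ∷ ps) with elemᵇ x (f sg)
... | true  = just ([] , sg , ps)
... | false with findSeg f x ps
...   | nothing               = nothing
...   | just (pre , y , post) = just (sg ∷ pre , y , post)

findRed≡findSeg : ∀ r ord → findRed r ord ≡ findSeg segReds r ord
findRed≡findSeg r [] = refl
findRed≡findSeg r (sg ∷ ps) with elemᵇ r (segReds sg)
... | true  = refl
... | false with findRed r ps | findSeg segReds r ps | findRed≡findSeg r ps
...   | nothing | .nothing | refl = refl
...   | just _  | .(just _) | refl = refl

findSeg-sound : ∀ f x ord {pre y post} → findSeg f x ord ≡ just (pre , y , post) →
                ord ≡ pre ++ y ∷ post × elemᵇ x (f y) ≡ true
findSeg-sound f x (sg ∷ ps) eq with elemᵇ x (f sg) in x∈sg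
findSeg-sound f x (sg ∷ ps) refl | true = refl , x∈sg
... | false with findSeg f x ps in eq′
findSeg-sound f x (sg ∷ ps) refl | false | just _ with findSeg-sound f x ps eq′
... | refl , x∈y = refl , x∈y

findSeg-complete : ∀ f x ord → x ∈ concatMap f ord →
                   Σ (List Seg × Seg × List Seg) λ res → findSeg f x ord ≡ just res
findSeg-complete f x (sg ∷ ps) x∈ with elemᵇ x (f sg) in x∉sg
... | true  = _ , refl
... | false with ∈-++⁻ (f sg) x∈
...   | inj₁ x∈sg with () ← ≡-trans (sym (∈⇒elemᵇ x∈sg)) x∉sg
...   | inj₂ x∈ps with findSeg f x ps | findSeg-complete f x ps x∈ps
...     | just _ | _ = _ , refl

findSeg-first : ∀ f x pre y post → All (λ sg → elemᵇ x (f sg) ≡ false) pre → elemᵇ x (f y) ≡ true →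
                findSeg f x (pre ++ y ∷ post) ≡ just (pre , y , post)
findSeg-first f x []         y post []       x∈y rewrite x∈y = refl
findSeg-first f x (sg ∷ pre) y post (x∉sg ∷ x∉pre) x∈y
  rewrite x∉sg | findSeg-first f x pre y post x∉pre x∈y = refl

findRed-first : ∀ r pre y post → All (λ sg → elemᵇ r (segReds sg) ≡ false) pre → elemᵇ r (segReds y) ≡ true →
                findRed r (pre ++ y ∷ post) ≡ just (pre , y , post)
findRed-first r pre y post r∉pre r∈y =
  ≡-trans (findRed≡findSeg r (pre ++ y ∷ post)) (findSeg-first segReds r pre y post r∉pre r∈y)

GroupOK : List Bar → Set
GroupOK g = Linked AdjOK (map barE g ++ [ pairE ])

PairOK : Pair → Set
PairOK p = Increasing (blues p) × Increasing (reds p) × NonEmpty (blues p) × NonEmpty (reds p)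

SegOK : Seg → Set
SegOK sg = GroupOK (segBars sg) × PairOK (proj₂ sg)

BarsOK : ℕ → List Bar → Set
BarsOK m bs = blueLabels bs ↭ range 1 m × redLabels bs ↭ range 0 (suc m)

-- InC with the two partitioned ranges left abstract and the bar order split group by group.
record WellFormed (m : ℕ) (BL RL : List ℕ) (s : BCS) : Set where
  constructor mkWF
  field
    bars       : BarsOK m (allBars s)
    segs       : All SegOK (ordinary s)
    extraGroup : GroupOK (extraBars s)
    extraBInc  : Increasing (extraB s)
    extraRInc  : Increasing (extraR s)
    bluePart   : ordBlues s ++ extraB s ↭ BL
    redPart    : ordReds s ++ extraR s ↭ RL

blueLabel : Bar → Maybe ℕ
blueLabel (blueBar i) = just i
blueLabel (redBar _)  = nothing

redLabel : Bar → Maybe ℕ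
redLabel (blueBar _) = nothing
redLabel (redBar i)  = just i

blueLabels≡mapMaybe : ∀ bs → blueLabels bs ≡ mapMaybe blueLabel bs
blueLabels≡mapMaybe []               = refl
blueLabels≡mapMaybe (blueBar i ∷ bs) = cong (i ∷_) (blueLabels≡mapMaybe bs)
blueLabels≡mapMaybe (redBar _ ∷ bs)  = blueLabels≡mapMaybe bs

redLabels≡mapMaybe : ∀ bs → redLabels bs ≡ mapMaybe redLabel bs
redLabels≡mapMaybe []               = refl
redLabels≡mapMaybe (blueBar _ ∷ bs) = redLabels≡mapMaybe bs
redLabels≡mapMaybe (redBar i ∷ bs)  = cong (i ∷_) (redLabels≡mapMaybe bs)

BarsOK-resp-↭ : ∀ {m xs ys} → xs ↭ ys → BarsOK m xs → BarsOK m ys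
BarsOK-resp-↭ {xs = xs} {ys} xs↭ys (blue , red)
  rewrite blueLabels≡mapMaybe xs | blueLabels≡mapMaybe ys
        | redLabels≡mapMaybe xs  | redLabels≡mapMaybe ys
  = trans (↭.mapMaybe-↭ blueLabel (↭-sym xs↭ys)) blue
  , trans (↭.mapMaybe-↭ redLabel (↭-sym xs↭ys)) red

segElems : Seg → List Elem
segElems sg = map barE (segBars sg) ++ [ pairE ]

Linked-tail : ∀ {x xs} → Linked AdjOK (x ∷ xs) → Linked AdjOK xs
Linked-tail [-]     = []
Linked-tail (_ ∷ l) = l

Linked-pairE∷ : ∀ zs → Linked AdjOK zs → Linked AdjOK (pairE ∷ zs)
Linked-pairE∷ []      _ = [-]
Linked-pairE∷ (_ ∷ _) l = tt ∷ l

-- A pair imposes no constraint on what follows it, so the bar order splits at pairs.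
group-split : ∀ g zs → Linked AdjOK ((map barE g ++ [ pairE ]) ++ zs) → GroupOK g × Linked AdjOK zs
group-split []           zs l       = [-] , Linked-tail l
group-split (b ∷ [])     zs (p ∷ l) = p ∷ [-] , Linked-tail l
group-split (b ∷ b′ ∷ g) zs (p ∷ l) with group-split (b′ ∷ g) zs l
... | g-ok , zs-ok = p ∷ g-ok , zs-ok

group-join : ∀ g zs → GroupOK g → Linked AdjOK zs → Linked AdjOK ((map barE g ++ [ pairE ]) ++ zs)
group-join []           zs _          l = Linked-pairE∷ zs l
group-join (b ∷ [])     zs (p ∷ _)    l = p ∷ Linked-pairE∷ zs l
group-join (b ∷ b′ ∷ g) zs (p ∷ g-ok) l = p ∷ group-join (b′ ∷ g) zs g-ok l

segs-split : ∀ ord E → Linked AdjOK (concatMap segElems ord ++ E) →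
             All (GroupOK ∘ segBars) ord × Linked AdjOK E
segs-split []        E l = [] , l
segs-split (sg ∷ ps) E l rewrite ++-assoc (segElems sg) (concatMap segElems ps) E
  with group-split (segBars sg) _ l
... | sg-ok , rest with segs-split ps E rest
... | ps-ok , E-ok = sg-ok ∷ ps-ok , E-ok

segs-join : ∀ ord E → All (GroupOK ∘ segBars) ord → Linked AdjOK E →
            Linked AdjOK (concatMap segElems ord ++ E)
segs-join []        E []             l = l
segs-join (sg ∷ ps) E (sg-ok ∷ ps-ok) l rewrite ++-assoc (segElems sg) (concatMap segElems ps) E
  = group-join (segBars sg) _ sg-ok (segs-join ps E ps-ok l)

InC⇒WellFormed : ∀ {m k n s} → InC m k n s → WellFormed m (range (suc m) k) (range (suc m) n) s
InC⇒WellFormed {s = mkBCS ord _ _ _} c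
  with segs-split ord _ (InC.barOrder c)
... | groups , extra =
  mkWF (InC.blueBarsOK c , InC.redBarsOK c)
       (All.zip (groups , All.zip (InC.ordBluesInc c , All.zip (InC.ordRedsInc c ,
                All.zip (InC.ordBluesNE c , InC.ordRedsNE c)))))
       extra (InC.extraBInc c) (InC.extraRInc c) (InC.bluePartition c) (InC.redPartition c)

WellFormed⇒InC : ∀ {m k n s} → WellFormed m (range (suc m) k) (range (suc m) n) s → InC m k n s
WellFormed⇒InC {s = mkBCS ord _ _ _} (mkWF (blue , red) segs extra eBI eRI bp rp)
  with All.unzip segs
... | groups , pairs with All.unzip pairs
... | bInc , rest with All.unzip rest
... | rInc , rest′ with All.unzip rest′
... | bNE , rNE = record
  { blueBarsOK = blue ; redBarsOK = red ; barOrder = segs-join ord _ groups extra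
  ; ordBluesInc = bInc ; ordRedsInc = rInc ; ordBluesNE = bNE ; ordRedsNE = rNE
  ; extraBInc = eBI ; extraRInc = eRI ; bluePartition = bp ; redPartition = rp }

-- Inserting and extracting the new maximal blue element

NoBarredSingleton : ℕ → List Seg → Set
NoBarredSingleton m′ = All (λ sg → segBlues sg ≡ [ m′ ] → segBars sg ≡ [])

All<⇒NoBarredSingleton : ∀ {m′} ps → All (_< m′) (concatMap segBlues ps) → NoBarredSingleton m′ ps
All<⇒NoBarredSingleton ps ps<m′ =
  All.map (λ sg<m′ sg≡ → ⊥-elim (All<⇒≢[-] sg<m′ sg≡)) (All-concatMap⁻ segBlues ps ps<m′)

NoBarredSingleton⇒¬Any : ∀ {m′} ps → NoBarredSingleton m′ ps →
                         ¬ Any (λ sg → segBlues sg ≡ [ m′ ] × ¬ (segBars sg ≡ [])) ps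
NoBarredSingleton⇒¬Any ps unbarred = All.All¬⇒¬Any (All.map (λ u (b , g≢[]) → g≢[] (u b)) unbarred)

¬Any⇒NoBarredSingleton : ∀ {m′} ps → ¬ Any (λ sg → segBlues sg ≡ [ m′ ] × ¬ (segBars sg ≡ [])) ps →
                         NoBarredSingleton m′ ps
¬Any⇒NoBarredSingleton {m′} ps ¬barred = All.map (λ {sg} → unbarred sg) (All.¬Any⇒All¬ ps ¬barred)
  where
  unbarred : ∀ sg → ¬ (segBlues sg ≡ [ m′ ] × ¬ (segBars sg ≡ [])) → segBlues sg ≡ [ m′ ] → segBars sg ≡ []
  unbarred ([] , _)    _       _ = refl
  unbarred (_ ∷ _ , _) ¬barred b = ⊥-elim (¬barred (b , λ ()))

-- The insertion step of φ: m′ joins the next blue block (A1, B1), unless the red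
-- block that lost r keeps elements R′, which then pair with {m′} (A2, B2).
insertMax : ℕ → List ℕ → List Seg → List ℕ → List Seg × List ℕ
insertMax m′ R′ ps eB with null R′
... | true  = addBlueFirst m′ ps eB
... | false = ([] , mkPair [ m′ ] R′) ∷ ps , eB

insertMax-bars : ∀ m′ R′ ps eB → concatMap segBars (proj₁ (insertMax m′ R′ ps eB)) ≡ concatMap segBars ps
insertMax-bars m′ R′ ps eB with null R′
insertMax-bars m′ R′ []      eB | true  = refl
insertMax-bars m′ R′ (_ ∷ _) eB | true  = refl
insertMax-bars m′ R′ ps      eB | false = refl

insertMax-reds : ∀ m′ R′ ps eB →
                 concatMap segReds (proj₁ (insertMax m′ R′ ps eB)) ≡ R′ ++ concatMap segReds ps
insertMax-reds m′ R′ ps eB with null R′ in R′-null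
insertMax-reds m′ R′ []      eB | true  rewrite null-true⇒[] R′-null = refl
insertMax-reds m′ R′ (_ ∷ _) eB | true  rewrite null-true⇒[] R′-null = refl
insertMax-reds m′ R′ ps      eB | false = refl

insertMax-blues : ∀ m′ R′ ps eB → let (ps′ , eB′) = insertMax m′ R′ ps eB in
                  concatMap segBlues ps′ ++ eB′ ↭ (concatMap segBlues ps ++ eB) ++ [ m′ ]
insertMax-blues m′ R′ ps eB with null R′
insertMax-blues m′ R′ []             eB | true = ↭-refl
insertMax-blues m′ R′ ((g , p) ∷ ps) eB | true =
  solve 4 (λ b bs e m → ((b ⊕ m) ⊕ bs) ⊕ e ⊜ ((b ⊕ bs) ⊕ e) ⊕ m) ↭-refl
    (blues p) (concatMap segBlues ps) eB [ m′ ]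
insertMax-blues m′ R′ ps eB | false =
  solve 3 (λ m bs e → (m ⊕ bs) ⊕ e ⊜ (bs ⊕ e) ⊕ m) ↭-refl [ m′ ] (concatMap segBlues ps) eB

insertMax-segs : ∀ {m′} R′ ps eB → All SegOK ps → All (_< m′) (concatMap segBlues ps) → Increasing R′ →
                 All SegOK (proj₁ (insertMax m′ R′ ps eB))
insertMax-segs R′ ps eB ps-ok ps<m′ R′-inc with null R′ in R′-null
insertMax-segs R′ [] eB [] _ _ | true = []
insertMax-segs R′ ((g , p) ∷ ps) eB ((g-ok , bInc , rInc , _ , rNE) ∷ ps-ok) ps<m′ _ | true =
  (g-ok , Increasing-∷ʳ (blues p) bInc (All.++⁻ˡ (blues p) ps<m′) , rInc , NonEmpty-∷ʳ _ (blues p) , rNE) ∷ ps-ok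
... | false = ([-] , [-] , R′-inc , (λ ()) , null-false⇒NonEmpty R′-null) ∷ ps-ok

insertMax-extraB-inc : ∀ {m′} R′ ps eB → Increasing eB → All (_< m′) eB →
                       Increasing (proj₂ (insertMax m′ R′ ps eB))
insertMax-extraB-inc R′ ps eB eB-inc eB<m′ with null R′
insertMax-extraB-inc R′ []      eB eB-inc eB<m′ | true  = Increasing-∷ʳ eB eB-inc eB<m′
insertMax-extraB-inc R′ (_ ∷ _) eB eB-inc eB<m′ | true  = eB-inc
insertMax-extraB-inc R′ ps      eB eB-inc eB<m′ | false = eB-inc

insertMax-unbarred : ∀ {m′} R′ ps eB → All SegOK ps → All (_< m′) (concatMap segBlues ps) →
                     NoBarredSingleton m′ (proj₁ (insertMax m′ R′ ps eB))
insertMax-unbarred R′ ps eB ps-ok ps<m′ with null R′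
insertMax-unbarred R′ [] eB _ _ | true = []
insertMax-unbarred R′ ((g , p) ∷ ps) eB ((_ , _ , _ , bNE , _) ∷ _) ps<m′ | true =
  (λ b≡ → ⊥-elim (∷ʳ≢[-] bNE b≡)) ∷ All<⇒NoBarredSingleton ps (All.++⁻ʳ (blues p) ps<m′)
... | false = (λ _ → refl) ∷ All<⇒NoBarredSingleton ps ps<m′

record Extraction : Set where
  constructor extraction
  field
    leftoverReds : List ℕ
    restSegs     : List Seg
    restBlues    : List ℕ
open Extraction

reinsertMax : ℕ → Extraction → List Seg × List ℕ
reinsertMax m′ (extraction R′ ps eB) = insertMax m′ R′ ps eB

-- Inverse of insertMax when m′ lies in the first blue block of the segments (in eB if there are none).
extractMax : ℕ → List Seg → List ℕ → Extraction
extractMax m′ []             eB = extraction [] [] (remove m′ eB)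
extractMax m′ ((g , p) ∷ ps) eB with null (remove m′ (blues p))
... | true  = extraction (reds p) ps eB
... | false = extraction [] ((g , mkPair (remove m′ (blues p)) (reds p)) ∷ ps) eB

MaxAtHead : ℕ → List Seg → List ℕ → Set
MaxAtHead m′ []       eB = elemᵇ m′ eB ≡ true
MaxAtHead m′ (sg ∷ _) _  = elemᵇ m′ (segBlues sg) ≡ true

extractMax-∷ʳ : ∀ {m′} g p ps eB → All (_< m′) (blues p) → NonEmpty (blues p) →
                extractMax m′ ((g , mkPair (blues p ++ [ m′ ]) (reds p)) ∷ ps) eB ≡ extraction [] ((g , p) ∷ ps) eB
extractMax-∷ʳ g p ps eB p<m′ bNE rewrite remove-∷ʳ p<m′ | NonEmpty⇒null-false bNE | remove-∷ʳ p<m′ = refl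

extractMax-insertMax : ∀ {m′} R′ ps eB → All SegOK ps → All (_< m′) (concatMap segBlues ps ++ eB) →
                       let (ps′ , eB′) = insertMax m′ R′ ps eB in extractMax m′ ps′ eB′ ≡ extraction R′ ps eB
extractMax-insertMax R′ ps eB ps-ok ps<m′ with null R′ in R′-null
extractMax-insertMax R′ [] eB _ eB<m′ | true
  rewrite null-true⇒[] R′-null | remove-∷ʳ eB<m′ = refl
extractMax-insertMax R′ ((g , p) ∷ ps) eB ((_ , _ , _ , bNE , _) ∷ _) ps<m′ | true
  rewrite null-true⇒[] R′-null = extractMax-∷ʳ g p ps eB (All.++⁻ˡ (blues p) (All.++⁻ˡ _ ps<m′)) bNE
extractMax-insertMax {m′} R′ ps eB _ _ | false rewrite remove-[-] m′ = refl

insertMax-extractMax : ∀ {m′} tail eB → MaxAtHead m′ tail eB → All SegOK tail → NoBarredSingleton m′ tail →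
                       Increasing eB → All (_≤ m′) (concatMap segBlues tail ++ eB) →
                       reinsertMax m′ (extractMax m′ tail eB) ≡ (tail , eB)
insertMax-extractMax [] eB m′∈eB _ _ eB-inc eB≤m′ = cong ([] ,_) (sym (split-max eB-inc eB≤m′ m′∈eB))
insertMax-extractMax {m′} ((g , p) ∷ ps) eB m′∈p ((_ , bInc , _ , _ , rNE) ∷ _) (unbarred ∷ _) _ tail≤m′
  with null (remove m′ (blues p)) in rest-null
     | split-max bInc (All.++⁻ˡ (blues p) (All.++⁻ˡ _ tail≤m′)) m′∈p
... | true | p-split rewrite NonEmpty⇒null-false rNE =
  cong (λ sg → sg ∷ ps , eB) (cong₂ _,_ (sym (unbarred p≡[m′])) (cong (λ b → mkPair b (reds p)) (sym p≡[m′])))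
  where
  p≡[m′] : blues p ≡ [ m′ ]
  p≡[m′] = ≡-trans p-split (cong (_++ [ m′ ]) (null-true⇒[] rest-null))
... | false | p-split = cong (λ b → (g , mkPair b (reds p)) ∷ ps , eB) (sym p-split)

reinsertMax-bars : ∀ m′ x {tail eB} → reinsertMax m′ x ≡ (tail , eB) →
                   concatMap segBars tail ≡ concatMap segBars (restSegs x)
reinsertMax-bars m′ (extraction R′ ps eB′) refl = insertMax-bars m′ R′ ps eB′

reinsertMax-reds : ∀ m′ x {tail eB} → reinsertMax m′ x ≡ (tail , eB) →
                   concatMap segReds tail ≡ leftoverReds x ++ concatMap segReds (restSegs x)
reinsertMax-reds m′ (extraction R′ ps eB′) refl = insertMax-reds m′ R′ ps eB′

reinsertMax-blues : ∀ m′ x {tail eB} → reinsertMax m′ x ≡ (tail , eB) →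
                    (concatMap segBlues (restSegs x) ++ restBlues x) ++ [ m′ ] ↭ concatMap segBlues tail ++ eB
reinsertMax-blues m′ (extraction R′ ps eB′) refl = ↭-sym (insertMax-blues m′ R′ ps eB′)

extractMax-segs : ∀ {m′} tail eB → MaxAtHead m′ tail eB → All SegOK tail →
                  All (_≤ m′) (concatMap segBlues tail) → All SegOK (restSegs (extractMax m′ tail eB))
extractMax-segs [] eB _ _ _ = []
extractMax-segs {m′} ((g , p) ∷ ps) eB m′∈p ((g-ok , bInc , rInc , _ , rNE) ∷ ps-ok) tail≤m′
  with null (remove m′ (blues p)) in rest-null
... | true  = ps-ok
... | false = (g-ok , Increasing-remove-max bInc (All.++⁻ˡ (blues p) tail≤m′) m′∈p , rInc
              , null-false⇒NonEmpty rest-null , rNE) ∷ ps-ok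

extractMax-restBlues-inc : ∀ {m′} tail eB → MaxAtHead m′ tail eB → Increasing eB → All (_≤ m′) eB →
                           Increasing (restBlues (extractMax m′ tail eB))
extractMax-restBlues-inc [] eB m′∈eB eB-inc eB≤m′ = Increasing-remove-max eB-inc eB≤m′ m′∈eB
extractMax-restBlues-inc {m′} ((g , p) ∷ ps) eB _ eB-inc _ with null (remove m′ (blues p))
... | true  = eB-inc
... | false = eB-inc

extractMax-leftover-inc : ∀ {m′} tail eB → All SegOK tail → Increasing (leftoverReds (extractMax m′ tail eB))
extractMax-leftover-inc [] eB _ = []
extractMax-leftover-inc {m′} ((g , p) ∷ ps) eB ((_ , _ , rInc , _) ∷ _) with null (remove m′ (blues p))
... | true  = rInc
... | false = []

-- φ and its inverse ψ

moveFront-bars : ∀ pre g p p′ post ps′ → concatMap segBars ps′ ≡ concatMap segBars post →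
                 concatMap segBars (pre ++ (g , p) ∷ post) ↭ concatMap segBars ((g , p′) ∷ pre ++ ps′)
moveFront-bars pre g p p′ post ps′ same
  rewrite concatMap-++ segBars pre ((g , p) ∷ post) | concatMap-++ segBars pre ps′ | same =
  ↭.shifts (concatMap segBars pre) g

moveFront-blues : ∀ {x : ℕ} pre g p R post ps′ eB eB′ →
                  concatMap segBlues ps′ ++ eB′ ↭ (concatMap segBlues post ++ eB) ++ [ x ] →
                  concatMap segBlues ((g , mkPair (blues p) R) ∷ pre ++ ps′) ++ eB′
                    ↭ (concatMap segBlues (pre ++ (g , p) ∷ post) ++ eB) ++ [ x ]
moveFront-blues {x} pre g p R post ps′ eB eB′ inserted
  rewrite concatMap-++ segBlues pre ps′ | concatMap-++ segBlues pre ((g , p) ∷ post) = begin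
    (blues p ++ Pre ++ Ps′) ++ eB′
      ↭⟨ solve 4 (λ b pr ps e → (b ⊕ pr ⊕ ps) ⊕ e ⊜ (b ⊕ pr) ⊕ (ps ⊕ e)) ↭-refl (blues p) Pre Ps′ eB′ ⟩
    (blues p ++ Pre) ++ (Ps′ ++ eB′)
      ↭⟨ ↭.++⁺ˡ (blues p ++ Pre) inserted ⟩
    (blues p ++ Pre) ++ ((Post ++ eB) ++ [ x ])
      ↭⟨ solve 5 (λ b pr po e y → (b ⊕ pr) ⊕ ((po ⊕ e) ⊕ y) ⊜ ((pr ⊕ (b ⊕ po)) ⊕ e) ⊕ y)
           ↭-refl (blues p) Pre Post eB [ x ] ⟩
    ((Pre ++ blues p ++ Post) ++ eB) ++ [ x ] ∎
  where
  open PermutationReasoning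
  Pre Ps′ Post : List ℕ
  Pre  = concatMap segBlues pre
  Ps′  = concatMap segBlues ps′
  Post = concatMap segBlues post

moveFront-reds : ∀ {x : ℕ} pre g p eR post R′ ps′ → reds p ≡ R′ ++ [ x ] →
                 concatMap segReds ps′ ≡ R′ ++ concatMap segReds post →
                 (concatMap segReds ((g , mkPair (blues p) eR) ∷ pre ++ ps′) ++ []) ++ [ x ]
                   ↭ concatMap segReds (pre ++ (g , p) ∷ post) ++ eR
moveFront-reds {x} pre g p eR post R′ ps′ p≡ ps′≡
  rewrite concatMap-++ segReds pre ps′ | concatMap-++ segReds pre ((g , p) ∷ post) | p≡ | ps′≡ =
  solve 5 (λ e pr r po y → ((e ⊕ (pr ⊕ (r ⊕ po))) ⊕ id) ⊕ y ⊜ (pr ⊕ ((r ⊕ y) ⊕ po)) ⊕ e)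
    ↭-refl eR (concatMap segReds pre) R′ (concatMap segReds post) [ x ]

assemble : List Seg → List Bar → List Seg × List ℕ → BCS
assemble front eBars (ps , eB) = mkBCS (front ++ ps) eBars eB []

phi-A : ∀ m k n ord eBars eB eR → elemᵇ (m + n) eR ≡ true →
        phi m k n (mkBCS ord eBars eB eR) ≡ assemble [] eBars (insertMax (m + suc k) (remove (m + n) eR) ord eB)
phi-A m k n ord eBars eB eR r∈eR rewrite r∈eR with null (remove (m + n) eR)
... | true  = refl
... | false = refl

phi-B : ∀ m k n ord eBars eB eR {pre g p post} → elemᵇ (m + n) eR ≡ false →
        findRed (m + n) ord ≡ just (pre , (g , p) , post) →
        phi m k n (mkBCS ord eBars eB eR)
          ≡ assemble ((g , mkPair (blues p) eR) ∷ pre) eBars (insertMax (m + suc k) (remove (m + n) (reds p)) post eB)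
phi-B m k n ord eBars eB eR {p = p} r∉eR found rewrite r∉eR | found with null (remove (m + n) (reds p))
... | true  = refl
... | false = refl

splitAtMax : ℕ → List Seg → List ℕ → List Seg × List Seg
splitAtMax m′ ord eB with elemᵇ m′ eB
... | true  = ord , []
... | false with findSeg segBlues m′ ord
...   | just (pre , y , post) = pre , y ∷ post
...   | nothing               = ord , []

-- The first pair of front is the one φ moved (B1, B2): it returns behind the others
-- with red block R′ ∪ {r}, and its current red block becomes the extra one again.
restore : ℕ → List Bar → List Seg → Extraction → BCS
restore r eBars []              (extraction R′ ps eB) = mkBCS ps eBars eB (R′ ++ [ r ])
restore r eBars ((g , p) ∷ pre) (extraction R′ ps eB) =
  mkBCS (pre ++ (g , mkPair (blues p) (R′ ++ [ r ])) ∷ ps) eBars eB (reds p)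

psi : ℕ → ℕ → BCS → BCS
psi r m′ (mkBCS ord eBars eB _) = restore r eBars (proj₁ parts) (extractMax m′ (proj₂ parts) eB)
  where
  parts : List Seg × List Seg
  parts = splitAtMax m′ ord eB

splitAtMax-spec : ∀ m′ ord eB → m′ ∈ concatMap segBlues ord ++ eB →
                  let (front , tail) = splitAtMax m′ ord eB in ord ≡ front ++ tail × MaxAtHead m′ tail eB
splitAtMax-spec m′ ord eB m′∈ with elemᵇ m′ eB in m′∈eB
... | true  = sym (++-identityʳ ord) , m′∈eB
... | false with findSeg segBlues m′ ord in found
                | findSeg-complete segBlues m′ ord (∈-++-elemᵇ-false _ m′∈ m′∈eB)
...   | just _ | _ = findSeg-sound segBlues m′ ord found

splitAtMax-insertMax : ∀ {m′} front R′ ps eB →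
                       All (_< m′) (concatMap segBlues front) → All (_< m′) eB →
                       let (ps′ , eB′) = insertMax m′ R′ ps eB in splitAtMax m′ (front ++ ps′) eB′ ≡ (front , ps′)
splitAtMax-insertMax front R′ ps eB front<m′ eB<m′ with null R′
splitAtMax-insertMax {m′} front R′ [] eB front<m′ eB<m′ | true
  rewrite elemᵇ-∷ʳ m′ eB = cong (_, []) (++-identityʳ front)
splitAtMax-insertMax {m′} front R′ ((g , p) ∷ ps) eB front<m′ eB<m′ | true
  rewrite All<⇒elemᵇ-false eB<m′
        | findSeg-first segBlues m′ front (g , mkPair (blues p ++ [ m′ ]) (reds p)) ps
            (All.map All<⇒elemᵇ-false (All-concatMap⁻ segBlues front front<m′)) (elemᵇ-∷ʳ m′ (blues p)) = refl
splitAtMax-insertMax {m′} front R′ ps eB front<m′ eB<m′ | false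
  rewrite All<⇒elemᵇ-false eB<m′
        | findSeg-first segBlues m′ front ([] , mkPair [ m′ ] R′) ps
            (All.map All<⇒elemᵇ-false (All-concatMap⁻ segBlues front front<m′)) (elemᵇ-[-] m′) = refl

psi-assemble : ∀ r m′ front eBars R′ ps eB → All (_< m′) (concatMap segBlues front) →
               All SegOK ps → All (_< m′) (concatMap segBlues ps ++ eB) →
               psi r m′ (assemble front eBars (insertMax m′ R′ ps eB)) ≡ restore r eBars front (extraction R′ ps eB)
psi-assemble r m′ front eBars R′ ps eB front<m′ ps-ok ps<m′
  rewrite splitAtMax-insertMax front R′ ps eB front<m′ (All.++⁻ʳ (concatMap segBlues ps) ps<m′)
        | extractMax-insertMax R′ ps eB ps-ok ps<m′ = refl

phi-restore : ∀ m k n front eBars (x : Extraction) → All (_< m + n) (leftoverReds x) →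
              All (_< m + n) (concatMap segReds front) →
              phi m k n (restore (m + n) eBars front x) ≡ assemble front eBars (reinsertMax (m + suc k) x)
phi-restore m k n [] eBars (extraction R′ ps eB) R′<r _ =
  ≡-trans (phi-A m k n ps eBars eB (R′ ++ [ m + n ]) (elemᵇ-∷ʳ (m + n) R′))
          (cong (λ R → assemble [] eBars (insertMax (m + suc k) R ps eB)) (remove-∷ʳ R′<r))
phi-restore m k n ((g , p) ∷ pre) eBars (extraction R′ ps eB) R′<r front<r =
  ≡-trans (phi-B m k n _ eBars eB (reds p) (All<⇒elemᵇ-false (All.++⁻ˡ (reds p) front<r))
            (findRed-first (m + n) pre (g , mkPair (blues p) (R′ ++ [ m + n ])) ps
              (All.map All<⇒elemᵇ-false (All-concatMap⁻ segReds pre (All.++⁻ʳ (reds p) front<r)))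
              (elemᵇ-∷ʳ (m + n) R′)))
          (cong (λ R → assemble ((g , p) ∷ pre) eBars (insertMax (m + suc k) R ps eB)) (remove-∷ʳ R′<r))

module Bijection (m k n : ℕ) where

  -- n is the theorem's n − 1, so r and m′ are the paper's m+n and m+k+1.
  r : ℕ
  r = m + suc n

  m′ : ℕ
  m′ = m + suc k

  BL : List ℕ
  BL = range (suc m) k

  RL : List ℕ
  RL = range (suc m) n

  BL<m′ : All (_< m′) BL
  BL<m′ = range-All< (suc m) k (≤-reflexive (sym (+-suc m k)))

  RL<r : All (_< r) RL
  RL<r = range-All< (suc m) n (≤-reflexive (sym (+-suc m n)))

  Dom : BCS → Set
  Dom α = WellFormed m BL (RL ++ [ r ]) α × NonEmpty (extraR α)

  Cod : BCS → Set
  Cod γ = WellFormed m (BL ++ [ m′ ]) RL γ × extraR γ ≡ [] × NoBarredSingleton m′ (ordinary γ)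

  WF-blues<m′ : ∀ {RL′ α} → WellFormed m BL RL′ α → All (_< m′) (ordBlues α ++ extraB α)
  WF-blues<m′ wf = ↭.All-resp-↭ (↭-sym (WellFormed.bluePart wf)) BL<m′

  WF-reds≤r : ∀ {BL′ α} → WellFormed m BL′ (RL ++ [ r ]) α → All (_≤ r) (ordReds α ++ extraR α)
  WF-reds≤r wf = ↭.All-resp-↭ (↭-sym (WellFormed.redPart wf)) (All.∷ʳ⁺ (All.map <⇒≤ RL<r) ≤-refl)

  data PhiCase : BCS → Set where
    maxInExtra : ∀ ord eBars eB eR → elemᵇ r eR ≡ true → PhiCase (mkBCS ord eBars eB eR)
    maxInPair  : ∀ pre g p post eBars eB eR → elemᵇ r eR ≡ false → elemᵇ r (reds p) ≡ true →
                 findRed r (pre ++ (g , p) ∷ post) ≡ just (pre , (g , p) , post) →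
                 PhiCase (mkBCS (pre ++ (g , p) ∷ post) eBars eB eR)

  phiCase : ∀ α → WellFormed m BL (RL ++ [ r ]) α → PhiCase α
  phiCase (mkBCS ord eBars eB eR) wf = byExtra (elemᵇ r eR) refl
    where
    byExtra : ∀ b → elemᵇ r eR ≡ b → PhiCase (mkBCS ord eBars eB eR)
    byExtra true  r∈eR = maxInExtra ord eBars eB eR r∈eR
    byExtra false r∉eR with findSeg-complete segReds r ord r∈ord
      where
      r∈ord : r ∈ concatMap segReds ord
      r∈ord = ∈-++-elemᵇ-false _ (↭.∈-resp-↭ (↭-sym (WellFormed.redPart wf)) (∈-++⁺ʳ RL (here refl))) r∉eR
    ... | (pre , (g , p) , post) , found with findSeg-sound segReds r ord found
    ...   | refl , r∈p = maxInPair pre g p post eBars eB eR r∉eR r∈p (≡-trans (findRed≡findSeg r ord) found)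

  extraR-split : ∀ {ord eBars eB eR} → WellFormed m BL (RL ++ [ r ]) (mkBCS ord eBars eB eR) →
                 elemᵇ r eR ≡ true → eR ≡ remove r eR ++ [ r ]
  extraR-split {ord} wf r∈eR =
    split-max (WellFormed.extraRInc wf) (All.++⁻ʳ (concatMap segReds ord) (WF-reds≤r wf)) r∈eR

  pairReds-split : ∀ {pre g p post eBars eB eR} →
                   WellFormed m BL (RL ++ [ r ]) (mkBCS (pre ++ (g , p) ∷ post) eBars eB eR) →
                   elemᵇ r (reds p) ≡ true → reds p ≡ remove r (reds p) ++ [ r ]
  pairReds-split {pre} {g} {p} {post} wf r∈p
    with All.++⁻ pre (WellFormed.segs wf)
       | All-concatMap-mid⁻ segReds pre (g , p) post (All.++⁻ˡ _ (WF-reds≤r wf))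
  ... | _ , (_ , _ , rInc , _) ∷ _ | _ , p≤r , _ = split-max rInc p≤r r∈p

  phiA-Cod : ∀ ord eBars eB eR → elemᵇ r eR ≡ true → WellFormed m BL (RL ++ [ r ]) (mkBCS ord eBars eB eR) →
             Cod (assemble [] eBars (insertMax m′ (remove r eR) ord eB))
  phiA-Cod ord eBars eB eR r∈eR wf@(mkWF bars segs extra eB-inc eR-inc bp rp) =
    mkWF (subst (λ bs → BarsOK m (bs ++ eBars)) (sym (insertMax-bars m′ R′ ord eB)) bars)
         (insertMax-segs R′ ord eB segs ord<m′ R′-inc)
         extra (insertMax-extraB-inc R′ ord eB eB-inc eB<m′) []
         (trans (insertMax-blues m′ R′ ord eB) (↭.++⁺ʳ [ m′ ] bp))
         (subst (λ rs → rs ++ [] ↭ RL) (sym (insertMax-reds m′ R′ ord eB)) reds-part)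
    , refl , insertMax-unbarred R′ ord eB segs ord<m′
    where
    R′ : List ℕ
    R′ = remove r eR
    ord<m′ : All (_< m′) (concatMap segBlues ord)
    ord<m′ = All.++⁻ˡ _ (WF-blues<m′ wf)
    eB<m′ : All (_< m′) eB
    eB<m′ = All.++⁻ʳ (concatMap segBlues ord) (WF-blues<m′ wf)
    R′-inc : Increasing R′
    R′-inc = Increasing-++⁻ˡ R′ (subst Increasing (extraR-split wf r∈eR) eR-inc)
    reds-part : (R′ ++ concatMap segReds ord) ++ [] ↭ RL
    reds-part = ↭-∷ʳ-cancel _ RL (trans
      (solve 3 (λ R O y → ((R ⊕ O) ⊕ id) ⊕ y ⊜ O ⊕ (R ⊕ y)) ↭-refl R′ (concatMap segReds ord) [ r ])
      (subst (λ e → concatMap segReds ord ++ e ↭ RL ++ [ r ]) (extraR-split wf r∈eR) rp))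

  phiB-Cod : ∀ pre g p post eBars eB eR → elemᵇ r (reds p) ≡ true → NonEmpty eR →
             WellFormed m BL (RL ++ [ r ]) (mkBCS (pre ++ (g , p) ∷ post) eBars eB eR) →
             Cod (assemble ((g , mkPair (blues p) eR) ∷ pre) eBars (insertMax m′ (remove r (reds p)) post eB))
  phiB-Cod pre g p post eBars eB eR r∈p eR-ne wf@(mkWF bars segs extra eB-inc eR-inc bp rp)
    with All.++⁻ pre segs | All-concatMap-mid⁻ segBlues pre (g , p) post (All.++⁻ˡ _ (WF-blues<m′ wf))
  ... | pre-ok , (g-ok , bInc , rInc , bNE , _) ∷ post-ok | pre<m′ , p<m′ , post<m′ =
    mkWF (BarsOK-resp-↭ (↭.++⁺ʳ eBars (moveFront-bars pre g p p′ post _ (insertMax-bars m′ R′ post eB))) bars)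
         ((g-ok , bInc , eR-inc , bNE , eR-ne) ∷ All.++⁺ pre-ok (insertMax-segs R′ post eB post-ok post<m′ R′-inc))
         extra (insertMax-extraB-inc R′ post eB eB-inc eB<m′) []
         (trans (moveFront-blues pre g p eR post _ eB _ (insertMax-blues m′ R′ post eB)) (↭.++⁺ʳ [ m′ ] bp))
         (↭-∷ʳ-cancel _ RL (trans (moveFront-reds pre g p eR post R′ _ (pairReds-split wf r∈p)
                                                  (insertMax-reds m′ R′ post eB)) rp))
    , refl
    , (λ p≡ → ⊥-elim (All<⇒≢[-] p<m′ p≡))
      ∷ All.++⁺ (All<⇒NoBarredSingleton pre pre<m′) (insertMax-unbarred R′ post eB post-ok post<m′)
    where
    p′ : Pair
    p′ = mkPair (blues p) eR
    R′ : List ℕ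
    R′ = remove r (reds p)
    R′-inc : Increasing R′
    R′-inc = Increasing-++⁻ˡ R′ (subst Increasing (pairReds-split wf r∈p) rInc)
    eB<m′ : All (_< m′) eB
    eB<m′ = All.++⁻ʳ (concatMap segBlues (pre ++ (g , p) ∷ post)) (WF-blues<m′ wf)

  phi-Cod : ∀ α → Dom α → Cod (phi m k (suc n) α)
  phi-Cod α (wf , eR-ne) with phiCase α wf
  ... | maxInExtra ord eBars eB eR r∈eR =
    subst Cod (sym (phi-A m k (suc n) ord eBars eB eR r∈eR)) (phiA-Cod ord eBars eB eR r∈eR wf)
  ... | maxInPair pre g p post eBars eB eR r∉eR r∈p found =
    subst Cod (sym (phi-B m k (suc n) _ eBars eB eR r∉eR found)) (phiB-Cod pre g p post eBars eB eR r∈p eR-ne wf)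

  psi-phi : ∀ α → Dom α → psi r m′ (phi m k (suc n) α) ≡ α
  psi-phi α (wf , _) with phiCase α wf
  ... | maxInExtra ord eBars eB eR r∈eR =
    ≡-trans (cong (psi r m′) (phi-A m k (suc n) ord eBars eB eR r∈eR))
   (≡-trans (psi-assemble r m′ [] eBars (remove r eR) ord eB [] (WellFormed.segs wf) (WF-blues<m′ wf))
            (cong (mkBCS ord eBars eB) (sym (extraR-split wf r∈eR))))
  ... | maxInPair pre g p post eBars eB eR r∉eR r∈p found
    with All.++⁻ pre (WellFormed.segs wf)
       | All-concatMap-mid⁻ segBlues pre (g , p) post (All.++⁻ˡ _ (WF-blues<m′ wf))
  ...  | _ , _ ∷ post-ok | pre<m′ , p<m′ , post<m′ =
    ≡-trans (cong (psi r m′) (phi-B m k (suc n) _ eBars eB eR r∉eR found))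
   (≡-trans (psi-assemble r m′ ((g , mkPair (blues p) eR) ∷ pre) eBars (remove r (reds p)) post eB
              (All.++⁺ p<m′ pre<m′) post-ok (All.++⁺ post<m′ eB<m′))
            (cong (λ rs → mkBCS (pre ++ (g , mkPair (blues p) rs) ∷ post) eBars eB eR) (sym (pairReds-split wf r∈p))))
    where
    eB<m′ : All (_< m′) eB
    eB<m′ = All.++⁻ʳ (concatMap segBlues (pre ++ (g , p) ∷ post)) (WF-blues<m′ wf)

  WF-blues≤m′ : ∀ {RL′ γ} → WellFormed m (BL ++ [ m′ ]) RL′ γ → All (_≤ m′) (ordBlues γ ++ extraB γ)
  WF-blues≤m′ wf = ↭.All-resp-↭ (↭-sym (WellFormed.bluePart wf)) (All.∷ʳ⁺ (All.map <⇒≤ BL<m′) ≤-refl)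

  WF-reds<r : ∀ {BL′ γ} → WellFormed m BL′ RL γ → All (_< r) (ordReds γ ++ extraR γ)
  WF-reds<r wf = ↭.All-resp-↭ (↭-sym (WellFormed.redPart wf)) RL<r

  data PsiCase : BCS → Set where
    maxSplit : ∀ front tail eBars eB → splitAtMax m′ (front ++ tail) eB ≡ (front , tail) →
               MaxAtHead m′ tail eB → PsiCase (mkBCS (front ++ tail) eBars eB [])

  psiCase : ∀ γ → Cod γ → PsiCase γ
  psiCase (mkBCS ord eBars eB .[]) (wf , refl , _)
    with splitAtMax m′ ord eB in split | splitAtMax-spec m′ ord eB m′∈γ
    where
    m′∈γ : m′ ∈ concatMap segBlues ord ++ eB
    m′∈γ = ↭.∈-resp-↭ (↭-sym (WellFormed.bluePart wf)) (∈-++⁺ʳ BL (here refl))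
  ... | front , tail | refl , atHead = maxSplit front tail eBars eB split atHead

  psi-maxSplit : ∀ front tail eBars eB → splitAtMax m′ (front ++ tail) eB ≡ (front , tail) →
                 psi r m′ (mkBCS (front ++ tail) eBars eB []) ≡ restore r eBars front (extractMax m′ tail eB)
  psi-maxSplit front tail eBars eB split rewrite split = refl

  record Extracted (tail : List Seg) (eB : List ℕ) (x : Extraction) : Set where
    field
      reinserted  : reinsertMax m′ x ≡ (tail , eB)
      sameBars    : concatMap segBars tail ≡ concatMap segBars (restSegs x)
      redsSplit   : concatMap segReds tail ≡ leftoverReds x ++ concatMap segReds (restSegs x)
      bluesPerm   : (concatMap segBlues (restSegs x) ++ restBlues x) ++ [ m′ ] ↭ concatMap segBlues tail ++ eB
      restOK      : All SegOK (restSegs x)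
      restBInc    : Increasing (restBlues x)
      leftoverInc : Increasing (leftoverReds x)
      leftover<r  : All (_< r) (leftoverReds x)

  extracted : ∀ front tail eBars eB → WellFormed m (BL ++ [ m′ ]) RL (mkBCS (front ++ tail) eBars eB []) →
              NoBarredSingleton m′ (front ++ tail) → MaxAtHead m′ tail eB →
              Extracted tail eB (extractMax m′ tail eB)
  extracted front tail eBars eB wf unbarred atHead = record
    { reinserted  = reinserted
    ; sameBars    = reinsertMax-bars m′ x reinserted
    ; redsSplit   = reinsertMax-reds m′ x reinserted
    ; bluesPerm   = reinsertMax-blues m′ x reinserted
    ; restOK      = extractMax-segs tail eB atHead tail-ok (All.++⁻ˡ _ tail≤m′)
    ; restBInc    = extractMax-restBlues-inc tail eB atHead (WellFormed.extraBInc wf) (All.++⁻ʳ _ tail≤m′)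
    ; leftoverInc = extractMax-leftover-inc tail eB tail-ok
    ; leftover<r  = All.++⁻ˡ _ (subst (All (_< r)) (reinsertMax-reds m′ x reinserted) tail<r)
    }
    where
    x : Extraction
    x = extractMax m′ tail eB
    tail-ok : All SegOK tail
    tail-ok = All.++⁻ʳ front (WellFormed.segs wf)
    tail≤m′ : All (_≤ m′) (concatMap segBlues tail ++ eB)
    tail≤m′ = All.++⁺ (proj₂ (All-concatMap-++⁻ segBlues front tail (All.++⁻ˡ _ (WF-blues≤m′ wf))))
                      (All.++⁻ʳ _ (WF-blues≤m′ wf))
    tail<r : All (_< r) (concatMap segReds tail)
    tail<r = proj₂ (All-concatMap-++⁻ segReds front tail (All.++⁻ˡ _ (WF-reds<r wf)))
    reinserted : reinsertMax m′ x ≡ (tail , eB)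
    reinserted = insertMax-extractMax tail eB atHead tail-ok (All.++⁻ʳ front unbarred)
                   (WellFormed.extraBInc wf) tail≤m′

  restore-Dom : ∀ front tail eBars eB x → WellFormed m (BL ++ [ m′ ]) RL (mkBCS (front ++ tail) eBars eB []) →
                Extracted tail eB x → Dom (restore r eBars front x)
  restore-Dom [] tail eBars eB (extraction R′ ps eB′) (mkWF bars _ extra _ _ bp rp) ex =
    mkWF (subst (λ bs → BarsOK m (bs ++ eBars)) sameBars bars)
         restOK extra restBInc (Increasing-∷ʳ R′ leftoverInc leftover<r)
         (↭-∷ʳ-cancel _ BL (trans bluesPerm bp))
         (trans (solve 3 (λ ps R y → ps ⊕ (R ⊕ y) ⊜ ((R ⊕ ps) ⊕ id) ⊕ y) ↭-refl (concatMap segReds ps) R′ [ r ])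
                (↭.++⁺ʳ [ r ] (subst (λ rs → rs ++ [] ↭ RL) redsSplit rp)))
    , NonEmpty-∷ʳ r R′
    where open Extracted ex
  restore-Dom ((g , p) ∷ pre) tail eBars eB (extraction R′ ps eB′)
              (mkWF bars ((g-ok , bInc , rInc , bNE , rNE) ∷ segs) extra _ _ bp rp) ex =
    mkWF (BarsOK-resp-↭ (↭.++⁺ʳ eBars (↭-sym (moveFront-bars pre g p′ p ps tail sameBars))) bars)
         (All.++⁺ (All.++⁻ˡ pre segs)
                  ((g-ok , bInc , Increasing-∷ʳ R′ leftoverInc leftover<r , bNE , NonEmpty-∷ʳ r R′) ∷ restOK))
         extra restBInc rInc
         (↭-∷ʳ-cancel _ BL (trans (↭-sym (moveFront-blues pre g p′ (reds p) ps tail eB′ eB (↭-sym bluesPerm))) bp))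
         (trans (↭-sym (moveFront-reds pre g p′ (reds p) ps R′ tail refl redsSplit)) (↭.++⁺ʳ [ r ] rp))
    , rNE
    where
    open Extracted ex
    p′ : Pair
    p′ = mkPair (blues p) (R′ ++ [ r ])

  psi-Dom : ∀ γ → Cod γ → Dom (psi r m′ γ)
  psi-Dom γ cod@(wf , _ , unbarred) with psiCase γ cod
  ... | maxSplit front tail eBars eB split atHead =
    subst Dom (sym (psi-maxSplit front tail eBars eB split))
          (restore-Dom front tail eBars eB _ wf (extracted front tail eBars eB wf unbarred atHead))

  phi-psi : ∀ γ → Cod γ → phi m k (suc n) (psi r m′ γ) ≡ γ
  phi-psi γ cod@(wf , _ , unbarred) with psiCase γ cod
  ... | maxSplit front tail eBars eB split atHead =
    ≡-trans (cong (phi m k (suc n)) (psi-maxSplit front tail eBars eB split))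
   (≡-trans (phi-restore m k (suc n) front eBars _ leftover<r
              (proj₁ (All-concatMap-++⁻ segReds front tail (All.++⁻ˡ _ (WF-reds<r wf)))))
            (cong (assemble front eBars) reinserted))
    where open Extracted (extracted front tail eBars eB wf unbarred atHead)

  range-suc′ : ∀ l → range (suc m) (suc l) ≡ range (suc m) l ++ [ m + suc l ]
  range-suc′ l = ≡-trans (range-suc (suc m) l) (cong (λ x → range (suc m) l ++ [ x ]) (sym (+-suc m l)))

  InCRStar⇒Dom : ∀ {α} → InCRStar m k (suc n) α → Dom α
  InCRStar⇒Dom (inC , eR≢[]) =
    subst (λ RL′ → WellFormed m BL RL′ _) (range-suc′ n) (InC⇒WellFormed inC) , eR≢[]

  Dom⇒InCRStar : ∀ {α} → Dom α → InCRStar m k (suc n) α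
  Dom⇒InCRStar (wf , eR≢[]) =
    WellFormed⇒InC (subst (λ RL′ → WellFormed m BL RL′ _) (sym (range-suc′ n)) wf) , eR≢[]

  InCStar⇒Cod : ∀ {γ} → InCStar m (suc k) n γ → ¬ InCStarBar m (suc k) n γ → Cod γ
  InCStar⇒Cod {γ} γ∈@(inC , eR≡[]) γ∉ =
    subst (λ BL′ → WellFormed m BL′ RL _) (range-suc′ k) (InC⇒WellFormed inC) , eR≡[] ,
    ¬Any⇒NoBarredSingleton (ordinary γ) (λ barred → γ∉ (γ∈ , barred))

  Cod⇒InCStar : ∀ {γ} → Cod γ → InCStar m (suc k) n γ
  Cod⇒InCStar (wf , eR≡[] , _) =
    WellFormed⇒InC (subst (λ BL′ → WellFormed m BL′ RL _) (sym (range-suc′ k)) wf) , eR≡[]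

  Cod⇒¬InCStarBar : ∀ {γ} → Cod γ → ¬ InCStarBar m (suc k) n γ
  Cod⇒¬InCStarBar {γ} (_ , _ , unbarred) (_ , barred) = NoBarredSingleton⇒¬Any (ordinary γ) unbarred barred

mainTheorem1 : (n k m : ℕ) → 1 ≤ n →
    ((α : BCS) → InCRStar m k n α →
       InCStar m (suc k) (n ∸ 1) (phi m k n α) × ¬ InCStarBar m (suc k) (n ∸ 1) (phi m k n α))
    × ((α β : BCS) → InCRStar m k n α → InCRStar m k n β → phi m k n α ≡ phi m k n β → α ≡ β)
    × ((γ : BCS) → InCStar m (suc k) (n ∸ 1) γ → ¬ InCStarBar m (suc k) (n ∸ 1) γ →
       Σ BCS (λ α → InCRStar m k n α × phi m k n α ≡ γ))
mainTheorem1 (suc n) k m _ =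
    (λ α α∈ → let cod = phi-Cod α (InCRStar⇒Dom α∈) in Cod⇒InCStar cod , Cod⇒¬InCStarBar cod)
  , (λ α β α∈ β∈ same → ≡-trans (sym (psi-phi α (InCRStar⇒Dom α∈)))
                                (≡-trans (cong (psi r m′) same) (psi-phi β (InCRStar⇒Dom β∈))))
  , (λ γ γ∈ γ∉ → let cod = InCStar⇒Cod γ∈ γ∉ in
                   psi r m′ γ , Dom⇒InCRStar (psi-Dom γ cod) , phi-psi γ cod)
  where open Bijection m k n
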